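{- If $\mathcal{D}_h$ is a sound abstraction of $\mathcal{D}_l$ relative to a refinement mapping $m$, then for any sequence of ground high-level actions $\vec\alpha$ and any high-level situation-suppressed formula $\phi$: $\mathcal{D}_l\cup\mathcal{C}\models\forall s\forall s'.\,Do(m(\vec\alpha),S_0,s)\land Do(m(\vec\alpha),S_0,s')\supset(m(\phi)[s]\equiv m(\phi)[s'])$.
   Context: Situation calculus setting. Objects are a countably infinite set $\mathcal{N}$ of standard names (unique names and domain closure); no function symbols other than constants; no non-fluent predicates. Situations: $S_0$ and $do(a,s)$; $do([a_1,\dots,a_n],s)$ abbreviates $do(a_n,\dots,do(a_1,s)\dots)$, also written $do(\vec a,s)$. $Poss(a,s)$ means $a$ is executable in $s$; $Executable(s)$ means every action along the history from $S_0$ to $s$ was possible where performed. A basic action theory (BAT) over finitely many action types $\mathcal{A}$ and fluents $\mathcal{F}$ consists of initial-state axioms $\mathcal{D}_{S_0}$, precondition axioms $Poss(A(\vec x),s)\equiv\phi^{Poss}_A(\vec x,s)$, successor state axioms $F(\vec x,do(a,s))\equiv\phi^{ssa}_F(\vec x,a,s)$ (right-hand sides uniform in $s$), unique names/domain closure axioms for actions $\mathcal{D}_{ca}$ and for objects $\mathcal{D}_{coa}$, and foundational axioms $\Sigma$. A situation-suppressed formula omits situation arguments of fluents; $\phi[s]$ restores $s$. ConGolog programs $\delta::=\alpha\mid\varphi?\mid\delta_1;\delta_2\mid\delta_1|\delta_2\mid\pi x.\delta\mid\delta^*\mid\delta_1\|\delta_2$, $nil=True?$; $\mathcal{C}$ are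 the axioms: $Trans(\alpha,s,\delta',s')\equiv s'=do(\alpha,s)\land Poss(\alpha,s)\land\delta'=True?$; $Trans(\varphi?,s,\delta',s')\equiv False$; $Trans(\delta_1;\delta_2,s,\delta',s')\equiv\exists\delta_1'(Trans(\delta_1,s,\delta_1',s')\land\delta'=\delta_1';\delta_2)\lor(Final(\delta_1,s)\land Trans(\delta_2,s,\delta',s'))$; $Trans(\delta_1|\delta_2,\cdot)\equiv Trans(\delta_1,\cdot)\lor Trans(\delta_2,\cdot)$; $Trans(\pi x.\delta,s,\delta',s')\equiv\exists x.Trans(\delta,s,\delta',s')$; $Trans(\delta^*,s,\delta',s')\equiv\exists\delta''(Trans(\delta,s,\delta'',s')\land\delta'=\delta'';\delta^*)$; $Trans(\delta_1\|\delta_2,s,\delta',s')\equiv\exists\delta_1'(Trans(\delta_1,s,\delta_1',s')\land\delta'=\delta_1'\|\delta_2)\lor\exists\delta_2'(Trans(\delta_2,s,\delta_2',s')\land\delta'=\delta_1\|\delta_2')$; $Final(\alpha,s)\equiv False$; $Final(\varphi?,s)\equiv\varphi[s]$; $Final(\delta_1;\delta_2,s)\equiv Final(\delta_1,s)\land Final(\delta_2,s)$; $Final(\delta_1|\delta_2,s)\equiv Final(\delta_1,s)\lor Final(\delta_2,s)$; $Final(\pi x.\delta,s)\equiv\exists x.Final(\delta,s)$; $Final(\delta^*,s)\equiv True$; $Final(\delta_1\|\delta_2,s)\equiv Final(\delta_1,s)\land Final(\delta_2,s)$. $Do(\delta,s,s')\doteq\exists\delta'.Trans^*(\delta,s,\delta',s')\land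 Final(\delta',s')$, $Trans^*$ the reflexive transitive closure. $\mathcal{D}_h$ (high-level) and $\mathcal{D}_l$ (low-level) are BATs with action types $\mathcal{A}_h,\mathcal{A}_l$ and fluents $\mathcal{F}_h,\mathcal{F}_l$, sharing only $\mathcal{N}$. A refinement mapping $m$ maps each $A\in\mathcal{A}_h$ to a situation-determined ConGolog program $m(A(\vec x))$ over $\mathcal{D}_l$ with free variables $\vec x$, and each $F\in\mathcal{F}_h$ to a situation-suppressed low-level formula $m(F(\vec x))$; $m(\phi)$ substitutes $m(F(\vec x))$ for fluent atoms; $m(\alpha_1,\dots,\alpha_n)=m(\alpha_1);\dots;m(\alpha_n)$, $m(\epsilon)=nil$. For a model $M_h$ of $\mathcal{D}_h$ and a model $M_l$ of $\mathcal{D}_l\cup\mathcal{C}$: $s_h\simeq_m^{M_h,M_l}s_l$ iff for all $F\in\mathcal{F}_h$ and assignments $v$, $M_h,v[s/s_h]\models F(\vec x,s)$ iff $M_l,v[s/s_l]\models m(F(\vec x))[s]$. A relation $B$ between situation domains is an $m$-bisimulation if each $\langle s_h,s_l\rangle\in B$ satisfies: (1) $s_h\simeq_m^{M_h,M_l}s_l$; (2) for each $A\in\mathcal{A}_h$ and $v$, if some $s_h'$ has $M_h,v[s/s_h,s'/s_h']\models Poss(A(\vec x),s)\land s'=do(A(\vec x),s)$ then some $s_l'$ has $M_l,v[s/s_l,s'/s_l']\models Do(m(A(\vec x)),s,s')$ and $\langle s_h',s_l'\rangle\in B$; (3) conversely, if some $s_l'$ has $M_l,v[s/s_l,s'/s_l']\models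 Do(m(A(\vec x)),s,s')$ then some $s_h'$ has $M_h,v[s/s_h,s'/s_h']\models Poss(A(\vec x),s)\land s'=do(A(\vec x),s)$ and $\langle s_h',s_l'\rangle\in B$. $M_h\sim_m M_l$ iff some $m$-bisimulation contains $\langle S_0^{M_h},S_0^{M_l}\rangle$. $\mathcal{D}_h$ is a sound abstraction of $\mathcal{D}_l$ relative to $m$ iff for every model $M_l$ of $\mathcal{D}_l\cup\mathcal{C}$ there is a model $M_h$ of $\mathcal{D}_h$ with $M_h\sim_m M_l$. -}

module Defs where

open import Data.Nat using (ℕ; zero; suc; _≡ᵇ_)
open import Data.Fin using (Fin; toℕ)
open import Data.Vec using (Vec; []; _∷_; map; tabulate)
open import Data.List using (List; []; _∷_)
open import Data.Bool using (Bool; true; false; if_then_else_)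
open import Data.Product using (Σ; _×_; _,_; ∃)
open import Data.Sum using (_⊎_)
open import Data.Unit using (⊤)
open import Data.Empty using (⊥)
open import Relation.Nullary using (¬_)
open import Relation.Binary.PropositionalEquality using (_≡_)
open import Relation.Binary.Construct.Closure.ReflexiveTransitive using (Star)
open import Function.Bundles using (_⇔_)

-- Signatures: finitely many action types and fluents, each with an arity.
-- Objects are the standard names ℕ (unique names + domain closure).

record Sig : Set where
  field
    nA  : ℕ
    aAr : Fin nA → ℕ
    nF  : ℕ
    fAr : Fin nF → ℕ

open Sig public

data OTerm : Set where
  var : ℕ → OTerm
  nm  : ℕ → OTerm

module Syntax (S : Sig) where

  -- the action domain: ground action terms (unique names + domain closure
  -- for actions)
  Act : Set
  Act = Σ (Fin (nA S)) λ A → Vec ℕ (aAr S A)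

  data ATerm : Set where
    avar  : ℕ → ATerm
    aterm : (A : Fin (nA S)) → Vec OTerm (aAr S A) → ATerm

  -- situation-suppressed first-order formulas.  The index says whether the
  -- formula may mention actions (true) or only fluents/objects (false).
  data Fm : Bool → Set where
    ⊤ᶠ ⊥ᶠ : ∀ {b} → Fm b
    _=ₒ_  : ∀ {b} → OTerm → OTerm → Fm b
    fl    : ∀ {b} (F : Fin (nF S)) → Vec OTerm (fAr S F) → Fm b
    _=ₐ_  : ATerm → ATerm → Fm true
    ¬ᶠ_   : ∀ {b} → Fm b → Fm b
    _∧ᶠ_ _∨ᶠ_ _⇒ᶠ_ : ∀ {b} → Fm b → Fm b → Fm b
    ∀ₒ ∃ₒ : ∀ {b} → ℕ → Fm b → Fm b
    ∀ₐ ∃ₐ : ℕ → Fm true → Fm true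

  -- situations (foundational axioms Σ: situations are exactly the
  -- finite action histories)
  data Sit : Set where
    S₀  : Sit
    doₛ : Act → Sit → Sit

  record Env : Set where
    field
      obj : ℕ → ℕ
      act : ℕ → Act
  open Env public

  setO : Env → ℕ → ℕ → Env
  setO v x n = record v { obj = λ y → if y ≡ᵇ x then n else obj v y }

  setA : Env → ℕ → Act → Env
  setA v x a = record v { act = λ y → if y ≡ᵇ x then a else act v y }

  extend : ∀ {k} → Vec ℕ k → (ℕ → ℕ) → ℕ → ℕ
  extend []       f i       = f i
  extend (x ∷ xs) f zero    = x
  extend (x ∷ xs) f (suc i) = extend xs (λ j → f (suc j)) i

  evalO : Env → OTerm → ℕ
  evalO v (var x) = obj v x
  evalO v (nm n)  = n

  evalA : Env → ATerm → Act
  evalA v (avar a)     = act v a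
  evalA v (aterm A ts) = A , map (evalO v) ts

  record Structure : Set₁ where
    field
      Fl   : (F : Fin (nF S)) → Vec ℕ (fAr S F) → Sit → Set
      Poss : Act → Sit → Set
  open Structure public

  ⟦_⟧ : ∀ {b} → Fm b → Structure → Env → Sit → Set
  ⟦ ⊤ᶠ ⟧ M v s = ⊤
  ⟦ ⊥ᶠ ⟧ M v s = ⊥
  ⟦ t =ₒ u ⟧ M v s = evalO v t ≡ evalO v u
  ⟦ fl F ts ⟧ M v s = Fl M F (map (evalO v) ts) s
  ⟦ t =ₐ u ⟧ M v s = evalA v t ≡ evalA v u
  ⟦ ¬ᶠ φ ⟧ M v s = ¬ ⟦ φ ⟧ M v s
  ⟦ φ ∧ᶠ ψ ⟧ M v s = ⟦ φ ⟧ M v s × ⟦ ψ ⟧ M v s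
  ⟦ φ ∨ᶠ ψ ⟧ M v s = ⟦ φ ⟧ M v s ⊎ ⟦ ψ ⟧ M v s
  ⟦ φ ⇒ᶠ ψ ⟧ M v s = ⟦ φ ⟧ M v s → ⟦ ψ ⟧ M v s
  ⟦ ∀ₒ x φ ⟧ M v s = (n : ℕ) → ⟦ φ ⟧ M (setO v x n) s
  ⟦ ∃ₒ x φ ⟧ M v s = Σ ℕ λ n → ⟦ φ ⟧ M (setO v x n) s
  ⟦ ∀ₐ x φ ⟧ M v s = (a : Act) → ⟦ φ ⟧ M (setA v x a) s
  ⟦ ∃ₐ x φ ⟧ M v s = Σ Act λ a → ⟦ φ ⟧ M (setA v x a) s

  -- Conventions: in poss A the object variables
  -- 0 .. aAr A - 1 are the parameters x⃗; in ssa F the object variables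
  -- 0 .. fAr F - 1 are x⃗ and the action variable 0 is a.
  record BAT : Set₁ where
    field
      Init : Fm true → Set
      poss : (A : Fin (nA S)) → Fm true
      ssa  : (F : Fin (nF S)) → Fm true

  record Model (D : BAT) : Set₁ where
    field
      str     : Structure
      initOK  : ∀ φ → BAT.Init D φ → ∀ v → ⟦ φ ⟧ str v S₀
      possOK  : ∀ A (ns : Vec ℕ (aAr S A)) s v →
                Poss str (A , ns) s ⇔ ⟦ BAT.poss D A ⟧ str (record v { obj = extend ns (obj v) }) s
      ssaOK   : ∀ F (ns : Vec ℕ (fAr S F)) a s v →
                Fl str F ns (doₛ a s) ⇔
                ⟦ BAT.ssa D F ⟧ str (setA (record v { obj = extend ns (obj v) }) 0 a) s
  open Model public

  Executable : Structure → Sit → Set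
  Executable M S₀         = ⊤
  Executable M (doₛ a s)  = Executable M s × Poss M a s

  infixr 5 _⨾_
  data Prog : Set where
    actP  : (A : Fin (nA S)) → Vec OTerm (aAr S A) → Prog
    test  : Fm true → Prog
    _⨾_   : Prog → Prog → Prog
    _∣_   : Prog → Prog → Prog
    π     : ℕ → Prog → Prog
    _*    : Prog → Prog
    _∥_   : Prog → Prog → Prog

  nil : Prog
  nil = test ⊤ᶠ

  substO : ℕ → ℕ → OTerm → OTerm
  substO x n (var y) = if y ≡ᵇ x then nm n else var y
  substO x n (nm k)  = nm k

  substAT : ℕ → ℕ → ATerm → ATerm
  substAT x n (avar a)     = avar a
  substAT x n (aterm A ts) = aterm A (map (substO x n) ts)

  substF : ∀ {b} → ℕ → ℕ → Fm b → Fm b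
  substF x n ⊤ᶠ = ⊤ᶠ
  substF x n ⊥ᶠ = ⊥ᶠ
  substF x n (t =ₒ u) = substO x n t =ₒ substO x n u
  substF x n (fl F ts) = fl F (map (substO x n) ts)
  substF x n (t =ₐ u) = substAT x n t =ₐ substAT x n u
  substF x n (¬ᶠ φ) = ¬ᶠ substF x n φ
  substF x n (φ ∧ᶠ ψ) = substF x n φ ∧ᶠ substF x n ψ
  substF x n (φ ∨ᶠ ψ) = substF x n φ ∨ᶠ substF x n ψ
  substF x n (φ ⇒ᶠ ψ) = substF x n φ ⇒ᶠ substF x n ψ
  substF x n (∀ₒ y φ) = if y ≡ᵇ x then ∀ₒ y φ else ∀ₒ y (substF x n φ)
  substF x n (∃ₒ y φ) = if y ≡ᵇ x then ∃ₒ y φ else ∃ₒ y (substF x n φ)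
  substF x n (∀ₐ y φ) = ∀ₐ y (substF x n φ)
  substF x n (∃ₐ y φ) = ∃ₐ y (substF x n φ)

  substP : ℕ → ℕ → Prog → Prog
  substP x n (actP A ts) = actP A (map (substO x n) ts)
  substP x n (test φ)   = test (substF x n φ)
  substP x n (δ₁ ⨾ δ₂)  = substP x n δ₁ ⨾ substP x n δ₂
  substP x n (δ₁ ∣ δ₂)  = substP x n δ₁ ∣ substP x n δ₂
  substP x n (π y δ)    = if y ≡ᵇ x then π y δ else π y (substP x n δ)
  substP x n (δ *)      = substP x n δ *
  substP x n (δ₁ ∥ δ₂)  = substP x n δ₁ ∥ substP x n δ₂

  groundFrom : ∀ {k} → ℕ → Vec ℕ k → Prog → Prog
  groundFrom i []       δ = δ
  groundFrom i (n ∷ ns) δ = groundFrom (suc i) ns (substP i n δ)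

  -- the axioms C: Final and Trans (the unique solution of the
  -- equivalences, given inductively on program structure)
  data Final (M : Structure) (v : Env) : Prog → Sit → Set where
    fTest : ∀ {φ s} → ⟦ φ ⟧ M v s → Final M v (test φ) s
    fSeq  : ∀ {δ₁ δ₂ s} → Final M v δ₁ s → Final M v δ₂ s → Final M v (δ₁ ⨾ δ₂) s
    fChL  : ∀ {δ₁ δ₂ s} → Final M v δ₁ s → Final M v (δ₁ ∣ δ₂) s
    fChR  : ∀ {δ₁ δ₂ s} → Final M v δ₂ s → Final M v (δ₁ ∣ δ₂) s
    fPi   : ∀ {x δ s} (n : ℕ) → Final M v (substP x n δ) s → Final M v (π x δ) s
    fStar : ∀ {δ s} → Final M v (δ *) s
    fPar  : ∀ {δ₁ δ₂ s} → Final M v δ₁ s → Final M v δ₂ s → Final M v (δ₁ ∥ δ₂) s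

  data Trans (M : Structure) (v : Env) : Prog → Sit → Prog → Sit → Set where
    tAct  : ∀ {A ts s} → Poss M (A , map (evalO v) ts) s →
            Trans M v (actP A ts) s nil (doₛ (A , map (evalO v) ts) s)
    tSeq₁ : ∀ {δ₁ δ₁′ δ₂ s s′} → Trans M v δ₁ s δ₁′ s′ →
            Trans M v (δ₁ ⨾ δ₂) s (δ₁′ ⨾ δ₂) s′
    tSeq₂ : ∀ {δ₁ δ₂ δ′ s s′} → Final M v δ₁ s → Trans M v δ₂ s δ′ s′ →
            Trans M v (δ₁ ⨾ δ₂) s δ′ s′
    tChL  : ∀ {δ₁ δ₂ δ′ s s′} → Trans M v δ₁ s δ′ s′ → Trans M v (δ₁ ∣ δ₂) s δ′ s′
    tChR  : ∀ {δ₁ δ₂ δ′ s s′} → Trans M v δ₂ s δ′ s′ → Trans M v (δ₁ ∣ δ₂) s δ′ s′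
    tPi   : ∀ {x δ δ′ s s′} (n : ℕ) → Trans M v (substP x n δ) s δ′ s′ →
            Trans M v (π x δ) s δ′ s′
    tStar : ∀ {δ δ″ s s′} → Trans M v δ s δ″ s′ → Trans M v (δ *) s (δ″ ⨾ δ *) s′
    tParL : ∀ {δ₁ δ₁′ δ₂ s s′} → Trans M v δ₁ s δ₁′ s′ →
            Trans M v (δ₁ ∥ δ₂) s (δ₁′ ∥ δ₂) s′
    tParR : ∀ {δ₁ δ₂ δ₂′ s s′} → Trans M v δ₂ s δ₂′ s′ →
            Trans M v (δ₁ ∥ δ₂) s (δ₁ ∥ δ₂′) s′

  Conf : Set
  Conf = Prog × Sit

  TransC : Structure → Env → Conf → Conf → Set
  TransC M v (δ , s) (δ′ , s′) = Trans M v δ s δ′ s′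

  Trans* : Structure → Env → Prog → Sit → Prog → Sit → Set
  Trans* M v δ s δ′ s′ = Star (TransC M v) (δ , s) (δ′ , s′)

  Do : Structure → Env → Prog → Sit → Sit → Set
  Do M v δ s s′ = Σ Prog λ δ′ → Trans* M v δ s δ′ s′ × Final M v δ′ s′

  SitDetermined : Structure → Env → Prog → Sit → Set
  SitDetermined M v δ s = ∀ s′ δ′ δ″ →
    Trans* M v δ s δ′ s′ → Trans* M v δ s δ″ s′ → δ′ ≡ δ″

open Syntax public

module _ {Sh Sl : Sig} where
  module H = Syntax Sh
  module L = Syntax Sl

  -- m(A(x⃗)) : a low-level program whose parameters x⃗ are the object
  -- variables 0 .. aAr A - 1;  m(F(x⃗)) : a low-level situation-suppressed
  -- formula whose parameters are the object variables 0 .. fAr F - 1.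
  record Refinement : Set where
    field
      mA : (A : Fin (nA Sh)) → L.Prog
      mF : (F : Fin (nF Sh)) → L.Fm true
  open Refinement public

  IsRefinement : L.BAT → Refinement → Set₁
  IsRefinement Dl m = ∀ (Ml : L.Model Dl) (A : Fin (nA Sh)) (v : L.Env) (s : L.Sit) →
    L.Executable (str Ml) s → L.SitDetermined (str Ml) v (mA m A) s

  mGround : Refinement → H.Act → L.Prog
  mGround m (A , ns) = L.groundFrom 0 ns (mA m A)

  mSeq : Refinement → List H.Act → L.Prog
  mSeq m []           = L.nil
  mSeq m (α ∷ [])     = mGround m α
  mSeq m (α ∷ β ∷ αs) = mGround m α L.⨾ mSeq m (β ∷ αs)

  -- satisfaction of m(φ)[s] for a high-level situation-suppressed formula φ
  -- (only high-level fluents): each atom F(t⃗) is replaced by m(F(x⃗)) with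
  -- x⃗ := t⃗ (i.e. the semantics of the capture-avoiding substitution).
  m⟦_⟧ : H.Fm false → Refinement → L.Structure → L.Env → L.Sit → Set
  m⟦_⟧ φ m M v s = go φ v
    where
    go : H.Fm false → L.Env → Set
    go H.⊤ᶠ v = ⊤
    go H.⊥ᶠ v = ⊥
    go (t H.=ₒ u) v = L.evalO v t ≡ L.evalO v u
    go (H.fl F ts) v =
      L.⟦ mF m F ⟧ M (record v { obj = L.extend (map (L.evalO v) ts) (L.obj v) }) s
    go (H.¬ᶠ φ) v = ¬ go φ v
    go (φ H.∧ᶠ ψ) v = go φ v × go ψ v
    go (φ H.∨ᶠ ψ) v = go φ v ⊎ go ψ v
    go (φ H.⇒ᶠ ψ) v = go φ v → go ψ v
    go (H.∀ₒ x φ) v = (n : ℕ) → go φ (L.setO v x n)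
    go (H.∃ₒ x φ) v = Σ ℕ λ n → go φ (L.setO v x n)

  IsBisim : Refinement → H.Structure → L.Structure → (H.Sit → L.Sit → Set) → Set
  IsBisim m Mh Ml B = ∀ sh sl → B sh sl →
      (∀ (F : Fin (nF Sh)) (v : L.Env) →
         H.Fl Mh F (tabulate (λ i → L.obj v (toℕ i))) sh ⇔ L.⟦ mF m F ⟧ Ml v sl)
    ×
      (∀ (A : Fin (nA Sh)) (v : L.Env) →
         let a = (A , tabulate (λ i → L.obj v (toℕ i))) in
         (Σ H.Sit λ sh′ → H.Poss Mh a sh × sh′ ≡ H.doₛ a sh) →
         Σ L.Sit λ sl′ → L.Do Ml v (mA m A) sl sl′ × B (H.doₛ a sh) sl′)
    ×
      (∀ (A : Fin (nA Sh)) (v : L.Env) →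
         let a = (A , tabulate (λ i → L.obj v (toℕ i))) in
         ∀ sl′ → L.Do Ml v (mA m A) sl sl′ →
         Σ H.Sit λ sh′ → H.Poss Mh a sh × sh′ ≡ H.doₛ a sh × B sh′ sl′)

  Bisimilar : Refinement → H.Structure → L.Structure → Set₁
  Bisimilar m Mh Ml = Σ (H.Sit → L.Sit → Set) λ B → IsBisim m Mh Ml B × B H.S₀ L.S₀

  SoundAbstraction : H.BAT → L.BAT → Refinement → Set₁
  SoundAbstraction Dh Dl m = ∀ (Ml : L.Model Dl) →
    Σ (H.Model Dh) λ Mh → Bisimilar m (str Mh) (str Ml)

module Submission where

-- Soundness provides a high-level model Mh bisimilar to Ml. Following α⃗
-- through condition (3) of the bisimulation, every low-level situation
-- reached by executing m(α⃗) from S₀ is related to the one high-level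
-- situation do(α⃗, S₀); by condition (1) each m(F) then has the truth value
-- of F at do(α⃗, S₀) in both s and s′, hence so does m(φ). Condition (3)
-- speaks about m(A(x⃗)) under an assignment of x⃗, while m(α⃗) is built from
-- ground instances, so the technical core is the substitution lemma: an
-- execution of δ[x := n] under v is an execution of δ under v[x ↦ n].

open import Data.Bool using (true; false; T; if_then_else_)
open import Data.Bool.Properties using (T-≡)
open import Data.Empty using (⊥-elim)
open import Data.Fin using (toℕ)
open import Data.List using (List; []; _∷_)
open import Data.Nat using (ℕ; zero; suc; _≡ᵇ_)
open import Data.Nat.Properties using (≡ᵇ⇒≡; ≡⇒≡ᵇ)
open import Data.Product using (Σ; _×_; _,_; proj₁; proj₂)
open import Data.Product.Function.NonDependent.Propositional using (_×-⇔_)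
import Data.Product.Function.Dependent.Propositional as Dependent
open import Data.Sum.Function.Propositional using (_⊎-⇔_)
open import Data.Vec using (Vec; []; _∷_; map; tabulate)
open import Data.Vec.Properties using (map-∘; map-cong)
open import Function using (_∘_)
open import Function.Bundles using (_⇔_; mk⇔; Equivalence)
open import Function.Construct.Composition using (_⇔-∘_)
open import Function.Construct.Identity using (⇔-id)
open import Function.Construct.Symmetry using (⇔-sym)
open import Function.Related.Propositional using (equivalence)
open import Function.Related.TypeIsomorphisms using (→-cong-⇔; ¬-cong-⇔)
open import Relation.Binary.Construct.Closure.ReflexiveTransitive using (ε; _◅_)
open import Relation.Binary.PropositionalEquality
open import Relation.Nullary using (¬_)

open import Defs
  using (Sig; OTerm; var; nm; module Syntax; Refinement; IsRefinement; SoundAbstraction;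
         IsBisim; mF; mGround; mSeq; m⟦_⟧)

≡ᵇ-true⇒≡ : ∀ {m n} → (m ≡ᵇ n) ≡ true → m ≡ n
≡ᵇ-true⇒≡ {m} {n} e = ≡ᵇ⇒≡ m n (Equivalence.from T-≡ e)

≡ᵇ-true-unique : ∀ {x y} z → (z ≡ᵇ x) ≡ true → (z ≡ᵇ y) ≡ true → x ≡ y
≡ᵇ-true-unique {x} {y} z e₁ e₂ = trans (sym (≡ᵇ-true⇒≡ {z} {x} e₁)) (≡ᵇ-true⇒≡ {z} {y} e₂)

≡ᵇ-false⇒≢ : ∀ {m n} → (m ≡ᵇ n) ≡ false → ¬ m ≡ n
≡ᵇ-false⇒≢ {m} {n} e m≡n = subst T e (≡⇒≡ᵇ m n m≡n)

Π-cong-⇔ : {A : Set} {P Q : A → Set} → (∀ a → P a ⇔ Q a) → ((a : A) → P a) ⇔ ((a : A) → Q a)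
Π-cong-⇔ P⇔Q = mk⇔ (λ f a → Equivalence.to (P⇔Q a) (f a)) (λ g a → Equivalence.from (P⇔Q a) (g a))

Σ-cong-⇔ : {A : Set} {P Q : A → Set} → (∀ a → P a ⇔ Q a) → Σ A P ⇔ Σ A Q
Σ-cong-⇔ P⇔Q = Dependent.congˡ {k = equivalence} (λ {a} → P⇔Q a)

cong-⇔ : {A : Set} (P : A → Set) {x y : A} → x ≡ y → P x ⇔ P y
cong-⇔ P refl = ⇔-id _

cong₂-⇔ : {A B : Set} (R : A → B → Set) {x x′ : A} {y y′ : B} → x ≡ x′ → y ≡ y′ → R x y ⇔ R x′ y′
cong₂-⇔ R refl refl = ⇔-id _

map-map-cong : ∀ {A B C : Set} {k} {f : B → C} {g : A → B} {h : A → C} →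
               (∀ t → f (g t) ≡ h t) → (ts : Vec A k) → map f (map g ts) ≡ map h ts
map-map-cong f∘g≗h ts = trans (sym (map-∘ _ _ ts)) (map-cong f∘g≗h ts)

module SubstitutionAlgebra (S : Sig) where
  open Syntax S

  substO-idem : ∀ x n k t → substO x n (substO x k t) ≡ substO x k t
  substO-idem x n k (nm j) = refl
  substO-idem x n k (var y) with y ≡ᵇ x in e
  ... | true = refl
  ... | false rewrite e = refl

  substAT-idem : ∀ x n k t → substAT x n (substAT x k t) ≡ substAT x k t
  substAT-idem x n k (avar a) = refl
  substAT-idem x n k (aterm A ts) = cong (aterm A) (map-map-cong (substO-idem x n k) ts)

  substF-idem : ∀ {b} x n k (φ : Fm b) → substF x n (substF x k φ) ≡ substF x k φ
  substF-idem x n k ⊤ᶠ = refl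
  substF-idem x n k ⊥ᶠ = refl
  substF-idem x n k (t =ₒ u) = cong₂ _=ₒ_ (substO-idem x n k t) (substO-idem x n k u)
  substF-idem x n k (fl F ts) = cong (fl F) (map-map-cong (substO-idem x n k) ts)
  substF-idem x n k (t =ₐ u) = cong₂ _=ₐ_ (substAT-idem x n k t) (substAT-idem x n k u)
  substF-idem x n k (¬ᶠ φ) = cong ¬ᶠ_ (substF-idem x n k φ)
  substF-idem x n k (φ ∧ᶠ ψ) = cong₂ _∧ᶠ_ (substF-idem x n k φ) (substF-idem x n k ψ)
  substF-idem x n k (φ ∨ᶠ ψ) = cong₂ _∨ᶠ_ (substF-idem x n k φ) (substF-idem x n k ψ)
  substF-idem x n k (φ ⇒ᶠ ψ) = cong₂ _⇒ᶠ_ (substF-idem x n k φ) (substF-idem x n k ψ)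
  substF-idem x n k (∀ₒ y φ) with y ≡ᵇ x in e
  ... | true rewrite e = refl
  ... | false rewrite e = cong (∀ₒ y) (substF-idem x n k φ)
  substF-idem x n k (∃ₒ y φ) with y ≡ᵇ x in e
  ... | true rewrite e = refl
  ... | false rewrite e = cong (∃ₒ y) (substF-idem x n k φ)
  substF-idem x n k (∀ₐ y φ) = cong (∀ₐ y) (substF-idem x n k φ)
  substF-idem x n k (∃ₐ y φ) = cong (∃ₐ y) (substF-idem x n k φ)

  substP-idem : ∀ x n k δ → substP x n (substP x k δ) ≡ substP x k δ
  substP-idem x n k (actP A ts) = cong (actP A) (map-map-cong (substO-idem x n k) ts)
  substP-idem x n k (test φ) = cong test (substF-idem x n k φ)
  substP-idem x n k (δ ⨾ γ) = cong₂ _⨾_ (substP-idem x n k δ) (substP-idem x n k γ)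
  substP-idem x n k (δ ∣ γ) = cong₂ _∣_ (substP-idem x n k δ) (substP-idem x n k γ)
  substP-idem x n k (δ ∥ γ) = cong₂ _∥_ (substP-idem x n k δ) (substP-idem x n k γ)
  substP-idem x n k (δ *) = cong _* (substP-idem x n k δ)
  substP-idem x n k (π y δ) with y ≡ᵇ x in e
  ... | true rewrite e = refl
  ... | false rewrite e = cong (π y) (substP-idem x n k δ)

  substO-comm : ∀ {x y} n k → ¬ x ≡ y → ∀ t → substO x n (substO y k t) ≡ substO y k (substO x n t)
  substO-comm n k x≢y (nm j) = refl
  substO-comm {x} {y} n k x≢y (var z) with z ≡ᵇ y in e₁ | z ≡ᵇ x in e₂
  ... | true  | true  = ⊥-elim (x≢y (≡ᵇ-true-unique z e₂ e₁))
  ... | true  | false rewrite e₁ = refl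
  ... | false | true  rewrite e₂ = refl
  ... | false | false rewrite e₁ | e₂ = refl

  map-substO-comm : ∀ {x y j} n k → ¬ x ≡ y → (ts : Vec OTerm j) →
                    map (substO x n) (map (substO y k) ts) ≡ map (substO y k) (map (substO x n) ts)
  map-substO-comm n k x≢y ts =
    trans (map-map-cong (substO-comm n k x≢y) ts) (map-∘ _ _ ts)

  substAT-comm : ∀ {x y} n k → ¬ x ≡ y → ∀ t → substAT x n (substAT y k t) ≡ substAT y k (substAT x n t)
  substAT-comm n k x≢y (avar a) = refl
  substAT-comm n k x≢y (aterm A ts) = cong (aterm A) (map-substO-comm n k x≢y ts)

  substF-comm : ∀ {b x y} n k → ¬ x ≡ y → (φ : Fm b) →
                substF x n (substF y k φ) ≡ substF y k (substF x n φ)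
  substF-comm n k x≢y ⊤ᶠ = refl
  substF-comm n k x≢y ⊥ᶠ = refl
  substF-comm n k x≢y (t =ₒ u) = cong₂ _=ₒ_ (substO-comm n k x≢y t) (substO-comm n k x≢y u)
  substF-comm n k x≢y (fl F ts) = cong (fl F) (map-substO-comm n k x≢y ts)
  substF-comm n k x≢y (t =ₐ u) = cong₂ _=ₐ_ (substAT-comm n k x≢y t) (substAT-comm n k x≢y u)
  substF-comm n k x≢y (¬ᶠ φ) = cong ¬ᶠ_ (substF-comm n k x≢y φ)
  substF-comm n k x≢y (φ ∧ᶠ ψ) = cong₂ _∧ᶠ_ (substF-comm n k x≢y φ) (substF-comm n k x≢y ψ)
  substF-comm n k x≢y (φ ∨ᶠ ψ) = cong₂ _∨ᶠ_ (substF-comm n k x≢y φ) (substF-comm n k x≢y ψ)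
  substF-comm n k x≢y (φ ⇒ᶠ ψ) = cong₂ _⇒ᶠ_ (substF-comm n k x≢y φ) (substF-comm n k x≢y ψ)
  substF-comm {x = x} {y} n k x≢y (∀ₒ z φ) with z ≡ᵇ y in e₁ | z ≡ᵇ x in e₂
  ... | true  | true  = ⊥-elim (x≢y (≡ᵇ-true-unique z e₂ e₁))
  ... | true  | false rewrite e₁ | e₂ = refl
  ... | false | true  rewrite e₁ | e₂ = refl
  ... | false | false rewrite e₁ | e₂ = cong (∀ₒ z) (substF-comm n k x≢y φ)
  substF-comm {x = x} {y} n k x≢y (∃ₒ z φ) with z ≡ᵇ y in e₁ | z ≡ᵇ x in e₂
  ... | true  | true  = ⊥-elim (x≢y (≡ᵇ-true-unique z e₂ e₁))
  ... | true  | false rewrite e₁ | e₂ = refl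
  ... | false | true  rewrite e₁ | e₂ = refl
  ... | false | false rewrite e₁ | e₂ = cong (∃ₒ z) (substF-comm n k x≢y φ)
  substF-comm n k x≢y (∀ₐ z φ) = cong (∀ₐ z) (substF-comm n k x≢y φ)
  substF-comm n k x≢y (∃ₐ z φ) = cong (∃ₐ z) (substF-comm n k x≢y φ)

  substP-comm : ∀ {x y} n k → ¬ x ≡ y → ∀ δ → substP x n (substP y k δ) ≡ substP y k (substP x n δ)
  substP-comm n k x≢y (actP A ts) = cong (actP A) (map-substO-comm n k x≢y ts)
  substP-comm n k x≢y (test φ) = cong test (substF-comm n k x≢y φ)
  substP-comm n k x≢y (δ ⨾ γ) = cong₂ _⨾_ (substP-comm n k x≢y δ) (substP-comm n k x≢y γ)
  substP-comm n k x≢y (δ ∣ γ) = cong₂ _∣_ (substP-comm n k x≢y δ) (substP-comm n k x≢y γ)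
  substP-comm n k x≢y (δ ∥ γ) = cong₂ _∥_ (substP-comm n k x≢y δ) (substP-comm n k x≢y γ)
  substP-comm n k x≢y (δ *) = cong _* (substP-comm n k x≢y δ)
  substP-comm {x} {y} n k x≢y (π z δ) with z ≡ᵇ y in e₁ | z ≡ᵇ x in e₂
  ... | true  | true  = ⊥-elim (x≢y (≡ᵇ-true-unique z e₂ e₁))
  ... | true  | false rewrite e₁ | e₂ = refl
  ... | false | true  rewrite e₁ | e₂ = refl
  ... | false | false rewrite e₁ | e₂ = cong (π z) (substP-comm n k x≢y δ)

module Assignments (S : Sig) where
  open Syntax S

  infix 4 _≈_
  _≈_ : Env → Env → Set
  v ≈ w = obj v ≗ obj w × act v ≡ act w

  ≈-sym : ∀ {v w} → v ≈ w → w ≈ v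
  ≈-sym (o , a) = sym ∘ o , sym a

  setO-cong : ∀ {v w} x n → v ≈ w → setO v x n ≈ setO w x n
  setO-cong {v} {w} x n (o , a) = pointwise , a
    where
    pointwise : ∀ y → obj (setO v x n) y ≡ obj (setO w x n) y
    pointwise y with y ≡ᵇ x
    ... | true  = refl
    ... | false = o y

  setA-cong : ∀ {v w} x a → v ≈ w → setA v x a ≈ setA w x a
  setA-cong x a (o , a≡) = o , cong (λ f y → if y ≡ᵇ x then a else f y) a≡

  setO-overwrite : ∀ v x n k → setO (setO v x n) x k ≈ setO v x k
  setO-overwrite v x n k = pointwise , refl
    where
    pointwise : ∀ y → obj (setO (setO v x n) x k) y ≡ obj (setO v x k) y
    pointwise y with y ≡ᵇ x
    ... | true  = refl
    ... | false = refl

  setO-swap : ∀ v {x y} n k → ¬ x ≡ y → setO (setO v x n) y k ≈ setO (setO v y k) x n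
  setO-swap v {x} {y} n k x≢y = pointwise , refl
    where
    pointwise : ∀ z → obj (setO (setO v x n) y k) z ≡ obj (setO (setO v y k) x n) z
    pointwise z with z ≡ᵇ y in e₁ | z ≡ᵇ x in e₂
    ... | true  | true  = ⊥-elim (x≢y (≡ᵇ-true-unique z e₂ e₁))
    ... | true  | false = refl
    ... | false | true  = refl
    ... | false | false = refl

  evalO-cong : ∀ {v w} → v ≈ w → ∀ t → evalO v t ≡ evalO w t
  evalO-cong (o , _) (var x) = o x
  evalO-cong _       (nm n)  = refl

  evalA-cong : ∀ {v w} → v ≈ w → ∀ t → evalA v t ≡ evalA w t
  evalA-cong (_ , a) (avar x)     = cong (λ f → f x) a
  evalA-cong v≈w     (aterm A ts) = cong (A ,_) (map-cong (evalO-cong v≈w) ts)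

  ⟦⟧-cong : ∀ {b} (φ : Fm b) {M s v w} → v ≈ w → ⟦ φ ⟧ M v s ⇔ ⟦ φ ⟧ M w s
  ⟦⟧-cong ⊤ᶠ v≈w = ⇔-id _
  ⟦⟧-cong ⊥ᶠ v≈w = ⇔-id _
  ⟦⟧-cong (t =ₒ u) v≈w = cong₂-⇔ _≡_ (evalO-cong v≈w t) (evalO-cong v≈w u)
  ⟦⟧-cong (fl F ts) {M} {s} v≈w = cong-⇔ (λ ns → Fl M F ns s) (map-cong (evalO-cong v≈w) ts)
  ⟦⟧-cong (t =ₐ u) v≈w = cong₂-⇔ _≡_ (evalA-cong v≈w t) (evalA-cong v≈w u)
  ⟦⟧-cong (¬ᶠ φ) v≈w = ¬-cong-⇔ (⟦⟧-cong φ v≈w)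
  ⟦⟧-cong (φ ∧ᶠ ψ) v≈w = ⟦⟧-cong φ v≈w ×-⇔ ⟦⟧-cong ψ v≈w
  ⟦⟧-cong (φ ∨ᶠ ψ) v≈w = ⟦⟧-cong φ v≈w ⊎-⇔ ⟦⟧-cong ψ v≈w
  ⟦⟧-cong (φ ⇒ᶠ ψ) v≈w = →-cong-⇔ (⟦⟧-cong φ v≈w) (⟦⟧-cong ψ v≈w)
  ⟦⟧-cong (∀ₒ x φ) v≈w = Π-cong-⇔ λ n → ⟦⟧-cong φ (setO-cong x n v≈w)
  ⟦⟧-cong (∃ₒ x φ) v≈w = Σ-cong-⇔ λ n → ⟦⟧-cong φ (setO-cong x n v≈w)
  ⟦⟧-cong (∀ₐ x φ) v≈w = Π-cong-⇔ λ a → ⟦⟧-cong φ (setA-cong x a v≈w)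
  ⟦⟧-cong (∃ₐ x φ) v≈w = Σ-cong-⇔ λ a → ⟦⟧-cong φ (setA-cong x a v≈w)

  evalO-substO : ∀ v x n t → evalO v (substO x n t) ≡ evalO (setO v x n) t
  evalO-substO v x n (nm j) = refl
  evalO-substO v x n (var y) with y ≡ᵇ x
  ... | true  = refl
  ... | false = refl

  map-evalO-substO : ∀ {j} v x n (ts : Vec OTerm j) →
                     map (evalO v) (map (substO x n) ts) ≡ map (evalO (setO v x n)) ts
  map-evalO-substO v x n = map-map-cong (evalO-substO v x n)

  evalA-substAT : ∀ v x n t → evalA v (substAT x n t) ≡ evalA (setO v x n) t
  evalA-substAT v x n (avar a)     = refl
  evalA-substAT v x n (aterm A ts) = cong (A ,_) (map-evalO-substO v x n ts)

  ⟦substF⟧ : ∀ {b} (φ : Fm b) {M s} v x n → ⟦ substF x n φ ⟧ M v s ⇔ ⟦ φ ⟧ M (setO v x n) s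
  ⟦substF⟧ ⊤ᶠ v x n = ⇔-id _
  ⟦substF⟧ ⊥ᶠ v x n = ⇔-id _
  ⟦substF⟧ (t =ₒ u) v x n = cong₂-⇔ _≡_ (evalO-substO v x n t) (evalO-substO v x n u)
  ⟦substF⟧ (fl F ts) {M} {s} v x n = cong-⇔ (λ ns → Fl M F ns s) (map-evalO-substO v x n ts)
  ⟦substF⟧ (t =ₐ u) v x n = cong₂-⇔ _≡_ (evalA-substAT v x n t) (evalA-substAT v x n u)
  ⟦substF⟧ (¬ᶠ φ) v x n = ¬-cong-⇔ (⟦substF⟧ φ v x n)
  ⟦substF⟧ (φ ∧ᶠ ψ) v x n = ⟦substF⟧ φ v x n ×-⇔ ⟦substF⟧ ψ v x n
  ⟦substF⟧ (φ ∨ᶠ ψ) v x n = ⟦substF⟧ φ v x n ⊎-⇔ ⟦substF⟧ ψ v x n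
  ⟦substF⟧ (φ ⇒ᶠ ψ) v x n = →-cong-⇔ (⟦substF⟧ φ v x n) (⟦substF⟧ ψ v x n)
  ⟦substF⟧ (∀ₒ y φ) v x n with y ≡ᵇ x in e
  ... | true  with refl ← ≡ᵇ-true⇒≡ {y} {x} e =
    Π-cong-⇔ λ k → ⟦⟧-cong φ (≈-sym (setO-overwrite v y n k))
  ... | false =
    Π-cong-⇔ λ k → ⟦⟧-cong φ (setO-swap v k n (≡ᵇ-false⇒≢ e)) ⇔-∘ ⟦substF⟧ φ (setO v y k) x n
  ⟦substF⟧ (∃ₒ y φ) v x n with y ≡ᵇ x in e
  ... | true  with refl ← ≡ᵇ-true⇒≡ {y} {x} e =
    Σ-cong-⇔ λ k → ⟦⟧-cong φ (≈-sym (setO-overwrite v y n k))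
  ... | false =
    Σ-cong-⇔ λ k → ⟦⟧-cong φ (setO-swap v k n (≡ᵇ-false⇒≢ e)) ⇔-∘ ⟦substF⟧ φ (setO v y k) x n
  ⟦substF⟧ (∀ₐ y φ) v x n = Π-cong-⇔ λ a → ⟦substF⟧ φ (setA v y a) x n
  ⟦substF⟧ (∃ₐ y φ) v x n = Σ-cong-⇔ λ a → ⟦substF⟧ φ (setA v y a) x n

module Execution (S : Sig) where
  open Syntax S
  open SubstitutionAlgebra S
  open Assignments S

  Final-cong : ∀ {M v w δ s} → v ≈ w → Final M v δ s → Final M w δ s
  Final-cong v≈w (fTest {φ} h) = fTest (Equivalence.to (⟦⟧-cong φ v≈w) h)
  Final-cong v≈w (fSeq f g)    = fSeq (Final-cong v≈w f) (Final-cong v≈w g)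
  Final-cong v≈w (fChL f)      = fChL (Final-cong v≈w f)
  Final-cong v≈w (fChR f)      = fChR (Final-cong v≈w f)
  Final-cong v≈w (fPi n f)     = fPi n (Final-cong v≈w f)
  Final-cong v≈w fStar         = fStar
  Final-cong v≈w (fPar f g)    = fPar (Final-cong v≈w f) (Final-cong v≈w g)

  Trans-cong : ∀ {M v w δ s δ′ s′} → v ≈ w → Trans M v δ s δ′ s′ → Trans M w δ s δ′ s′
  Trans-cong {M} {w = w} v≈w (tAct {A} {ts} {s} p) =
    subst (λ ns → Trans M w (actP A ts) s nil (doₛ (A , ns) s)) (sym eq)
      (tAct (subst (λ ns → Poss M (A , ns) s) eq p))
    where eq = map-cong (evalO-cong v≈w) ts
  Trans-cong v≈w (tSeq₁ t)   = tSeq₁ (Trans-cong v≈w t)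
  Trans-cong v≈w (tSeq₂ f t) = tSeq₂ (Final-cong v≈w f) (Trans-cong v≈w t)
  Trans-cong v≈w (tChL t)    = tChL (Trans-cong v≈w t)
  Trans-cong v≈w (tChR t)    = tChR (Trans-cong v≈w t)
  Trans-cong v≈w (tPi n t)   = tPi n (Trans-cong v≈w t)
  Trans-cong v≈w (tStar t)   = tStar (Trans-cong v≈w t)
  Trans-cong v≈w (tParL t)   = tParL (Trans-cong v≈w t)
  Trans-cong v≈w (tParR t)   = tParR (Trans-cong v≈w t)

  Trans*-cong : ∀ {M v w δ s δ′ s′} → v ≈ w → Trans* M v δ s δ′ s′ → Trans* M w δ s δ′ s′
  Trans*-cong v≈w ε        = ε
  Trans*-cong v≈w (t ◅ ts) = Trans-cong v≈w t ◅ Trans*-cong v≈w ts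

  Do-cong : ∀ {M v w δ s s′} → v ≈ w → Do M v δ s s′ → Do M w δ s s′
  Do-cong v≈w (δ′ , ts , f) = δ′ , Trans*-cong v≈w ts , Final-cong v≈w f

  substP-shadowed : ∀ {x y} n k δ → y ≡ x → substP x n (substP y k δ) ≡ substP y k δ
  substP-shadowed n k δ refl = substP-idem _ n k δ

  Final-substP⁺ : ∀ {M v} x n {δ s} → Final M (setO v x n) δ s → Final M v (substP x n δ) s
  Final-substP⁺ {M} {v} x n {s = s} (fTest {φ} h) = fTest (Equivalence.from (⟦substF⟧ φ v x n) h)
  Final-substP⁺ x n (fSeq f g) = fSeq (Final-substP⁺ x n f) (Final-substP⁺ x n g)
  Final-substP⁺ x n (fChL f)   = fChL (Final-substP⁺ x n f)
  Final-substP⁺ x n (fChR f)   = fChR (Final-substP⁺ x n f)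
  Final-substP⁺ {M} {v} x n {s = s} (fPi {y} {δ} k f) with y ≡ᵇ x in e
  ... | true  = fPi k (subst (λ γ → Final M v γ s) (substP-shadowed n k δ (≡ᵇ-true⇒≡ e))
                        (Final-substP⁺ x n f))
  ... | false = fPi k (subst (λ γ → Final M v γ s) (substP-comm n k (≡ᵇ-false⇒≢ e ∘ sym) δ) (Final-substP⁺ x n f))
  Final-substP⁺ x n fStar      = fStar
  Final-substP⁺ x n (fPar f g) = fPar (Final-substP⁺ x n f) (Final-substP⁺ x n g)

  Trans-substP⁺ : ∀ {M v} x n {δ s δ′ s′} → Trans M (setO v x n) δ s δ′ s′ →
                  Trans M v (substP x n δ) s (substP x n δ′) s′
  Trans-substP⁺ {M} {v} x n (tAct {A} {ts} {s} p) =
    subst (λ ns → Trans M v (actP A (map (substO x n) ts)) s nil (doₛ (A , ns) s)) eq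
      (tAct (subst (λ ns → Poss M (A , ns) s) (sym eq) p))
    where eq = map-evalO-substO v x n ts
  Trans-substP⁺ x n (tSeq₁ t)   = tSeq₁ (Trans-substP⁺ x n t)
  Trans-substP⁺ x n (tSeq₂ f t) = tSeq₂ (Final-substP⁺ x n f) (Trans-substP⁺ x n t)
  Trans-substP⁺ x n (tChL t)    = tChL (Trans-substP⁺ x n t)
  Trans-substP⁺ x n (tChR t)    = tChR (Trans-substP⁺ x n t)
  Trans-substP⁺ {M} {v} x n (tPi {y} {δ} {δ′} {s} {s′} k t) with y ≡ᵇ x in e
  ... | true  = tPi k (subst (λ γ → Trans M v γ s (substP x n δ′) s′)
                        (substP-shadowed n k δ (≡ᵇ-true⇒≡ e)) (Trans-substP⁺ x n t))
  ... | false = tPi k (subst (λ γ → Trans M v γ s (substP x n δ′) s′)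
                        (substP-comm n k (≡ᵇ-false⇒≢ e ∘ sym) δ) (Trans-substP⁺ x n t))
  Trans-substP⁺ x n (tStar t)   = tStar (Trans-substP⁺ x n t)
  Trans-substP⁺ x n (tParL t)   = tParL (Trans-substP⁺ x n t)
  Trans-substP⁺ x n (tParR t)   = tParR (Trans-substP⁺ x n t)

  -- The graph of substP x n as an inductive family: unlike the equation
  -- substP x n δ ≡ δ₀, it can be inverted along a derivation about δ₀.
  data SubstP (x n : ℕ) : Prog → Prog → Set where
    sAct        : ∀ {A ts} → SubstP x n (actP A ts) (actP A (map (substO x n) ts))
    sTest       : ∀ {φ} → SubstP x n (test φ) (test (substF x n φ))
    sSeq        : ∀ {δ γ δ₀ γ₀} → SubstP x n δ δ₀ → SubstP x n γ γ₀ → SubstP x n (δ ⨾ γ) (δ₀ ⨾ γ₀)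
    sCh         : ∀ {δ γ δ₀ γ₀} → SubstP x n δ δ₀ → SubstP x n γ γ₀ → SubstP x n (δ ∣ γ) (δ₀ ∣ γ₀)
    sPar        : ∀ {δ γ δ₀ γ₀} → SubstP x n δ δ₀ → SubstP x n γ γ₀ → SubstP x n (δ ∥ γ) (δ₀ ∥ γ₀)
    sStar       : ∀ {δ δ₀} → SubstP x n δ δ₀ → SubstP x n (δ *) (δ₀ *)
    sPiShadowed : ∀ {δ} → SubstP x n (π x δ) (π x δ)
    sPi         : ∀ {y δ δ₀} → ¬ x ≡ y → SubstP x n δ δ₀ → SubstP x n (π y δ) (π y δ₀)

  SubstP⇒≡ : ∀ {x n δ δ₀} → SubstP x n δ δ₀ → substP x n δ ≡ δ₀
  SubstP⇒≡ sAct         = refl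
  SubstP⇒≡ sTest        = refl
  SubstP⇒≡ (sSeq p q)   = cong₂ _⨾_ (SubstP⇒≡ p) (SubstP⇒≡ q)
  SubstP⇒≡ (sCh p q)    = cong₂ _∣_ (SubstP⇒≡ p) (SubstP⇒≡ q)
  SubstP⇒≡ (sPar p q)   = cong₂ _∥_ (SubstP⇒≡ p) (SubstP⇒≡ q)
  SubstP⇒≡ (sStar p)    = cong _* (SubstP⇒≡ p)
  SubstP⇒≡ {x} sPiShadowed with x ≡ᵇ x in e
  ... | true  = refl
  ... | false = ⊥-elim (≡ᵇ-false⇒≢ {x} e refl)
  SubstP⇒≡ {x} (sPi {y} x≢y p) with y ≡ᵇ x in e
  ... | true  = ⊥-elim (x≢y (sym (≡ᵇ-true⇒≡ e)))
  ... | false = cong (π y) (SubstP⇒≡ p)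

  substP-SubstP : ∀ x n δ → SubstP x n δ (substP x n δ)
  substP-SubstP x n (actP A ts) = sAct
  substP-SubstP x n (test φ)    = sTest
  substP-SubstP x n (δ ⨾ γ)     = sSeq (substP-SubstP x n δ) (substP-SubstP x n γ)
  substP-SubstP x n (δ ∣ γ)     = sCh (substP-SubstP x n δ) (substP-SubstP x n γ)
  substP-SubstP x n (δ ∥ γ)     = sPar (substP-SubstP x n δ) (substP-SubstP x n γ)
  substP-SubstP x n (δ *)       = sStar (substP-SubstP x n δ)
  substP-SubstP x n (π y δ) with y ≡ᵇ x in e
  ... | true  with refl ← ≡ᵇ-true⇒≡ {y} {x} e = sPiShadowed
  ... | false = sPi (≡ᵇ-false⇒≢ e ∘ sym) (substP-SubstP x n δ)

  ≡⇒SubstP : ∀ {x n δ δ₀} → substP x n δ ≡ δ₀ → SubstP x n δ δ₀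
  ≡⇒SubstP {x} {n} {δ} refl = substP-SubstP x n δ

  SubstP-substP : ∀ {x n y k δ δ₀} → ¬ x ≡ y → SubstP x n δ δ₀ → SubstP x n (substP y k δ) (substP y k δ₀)
  SubstP-substP {x} {n} {y} {k} {δ} x≢y p =
    ≡⇒SubstP (trans (substP-comm n k x≢y δ) (cong (substP y k) (SubstP⇒≡ p)))

  -- In the sPiShadowed cases the value of x is irrelevant: a step of the
  -- instance at k under v is one of the body under v[x ↦ k] = v[x ↦ n][x ↦ k],
  -- and substituting k back gives a step of the instance under v[x ↦ n].
  Final-substP⁻ : ∀ {M v x n δ δ₀ s} → Final M v δ₀ s → SubstP x n δ δ₀ → Final M (setO v x n) δ s
  Final-substP⁻ {M} {v} {x} {n} (fTest {φ} h) (sTest {φ₀}) = fTest (Equivalence.to (⟦substF⟧ φ₀ v x n) h)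
  Final-substP⁻ (fSeq f g) (sSeq p q) = fSeq (Final-substP⁻ f p) (Final-substP⁻ g q)
  Final-substP⁻ (fChL f)   (sCh p q)  = fChL (Final-substP⁻ f p)
  Final-substP⁻ (fChR f)   (sCh p q)  = fChR (Final-substP⁻ f q)
  Final-substP⁻ fStar      (sStar p)  = fStar
  Final-substP⁻ (fPar f g) (sPar p q) = fPar (Final-substP⁻ f p) (Final-substP⁻ g q)
  Final-substP⁻ (fPi k f)  (sPi x≢y p) = fPi k (Final-substP⁻ f (SubstP-substP x≢y p))
  Final-substP⁻ {v = v} {x} {n} (fPi {δ = δ} k f) sPiShadowed =
    fPi k (Final-substP⁺ x k (Final-cong (≈-sym (setO-overwrite v x n k))
                                (Final-substP⁻ f (substP-SubstP x k δ))))

  Trans-substP⁻ : ∀ {M v x n δ δ₀ s δ₀′ s′} → Trans M v δ₀ s δ₀′ s′ → SubstP x n δ δ₀ →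
                  Σ Prog λ δ′ → SubstP x n δ′ δ₀′ × Trans M (setO v x n) δ s δ′ s′
  Trans-substP⁻ {M} {v} {x} {n} (tAct {A} {_} {s} p) (sAct {_} {ts}) =
    nil , sTest ,
    subst (λ ns → Trans M (setO v x n) (actP A ts) s nil (doₛ (A , ns) s)) (sym eq)
      (tAct (subst (λ ns → Poss M (A , ns) s) eq p))
    where eq = map-evalO-substO v x n ts
  Trans-substP⁻ (tSeq₁ t) (sSeq p q) with Trans-substP⁻ t p
  ... | δ′ , r , t′ = δ′ ⨾ _ , sSeq r q , tSeq₁ t′
  Trans-substP⁻ (tSeq₂ f t) (sSeq p q) with Trans-substP⁻ t q
  ... | δ′ , r , t′ = δ′ , r , tSeq₂ (Final-substP⁻ f p) t′
  Trans-substP⁻ (tChL t) (sCh p q) with Trans-substP⁻ t p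
  ... | δ′ , r , t′ = δ′ , r , tChL t′
  Trans-substP⁻ (tChR t) (sCh p q) with Trans-substP⁻ t q
  ... | δ′ , r , t′ = δ′ , r , tChR t′
  Trans-substP⁻ (tStar t) (sStar p) with Trans-substP⁻ t p
  ... | δ′ , r , t′ = δ′ ⨾ _ , sSeq r (sStar p) , tStar t′
  Trans-substP⁻ (tParL t) (sPar p q) with Trans-substP⁻ t p
  ... | δ′ , r , t′ = δ′ ∥ _ , sPar r q , tParL t′
  Trans-substP⁻ (tParR t) (sPar p q) with Trans-substP⁻ t q
  ... | δ′ , r , t′ = _ ∥ δ′ , sPar p r , tParR t′
  Trans-substP⁻ (tPi k t) (sPi x≢y p) with Trans-substP⁻ t (SubstP-substP x≢y p)
  ... | δ′ , r , t′ = δ′ , r , tPi k t′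
  Trans-substP⁻ {v = v} {x} {n} (tPi {δ = δ} k t) sPiShadowed
    with Trans-substP⁻ {n = k} t (substP-SubstP x k δ)
  ... | δ′ , r , t′ =
    substP x k δ′ ,
    ≡⇒SubstP (trans (substP-idem x n k δ′) (SubstP⇒≡ r)) ,
    tPi k (Trans-substP⁺ x k (Trans-cong (≈-sym (setO-overwrite v x n k)) t′))

  Do-substP⁻ : ∀ {M v} x n {δ s s′} → Do M v (substP x n δ) s s′ → Do M (setO v x n) δ s s′
  Do-substP⁻ x n {δ} (δ₀ , ts , f) = run ts f (substP-SubstP x n δ)
    where
    run : ∀ {M v δ δ₀ s δf sf} → Trans* M v δ₀ s δf sf → Final M v δf sf → SubstP x n δ δ₀ →
          Do M (setO v x n) δ s sf
    run {δ = δ} ε f p = δ , ε , Final-substP⁻ f p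
    run (t ◅ ts) f p with Trans-substP⁻ t p
    ... | δ′ , p′ , t′ with run ts f p′
    ... | δf , ts′ , f′ = δf , t′ ◅ ts′ , f′

  extendFrom : ∀ {k} → ℕ → Vec ℕ k → (ℕ → ℕ) → ℕ → ℕ
  extendFrom zero    ns f j       = extend ns f j
  extendFrom (suc i) ns f zero    = f zero
  extendFrom (suc i) ns f (suc j) = extendFrom i ns (f ∘ suc) j

  extendFrom-[] : ∀ i f → f ≗ extendFrom i [] f
  extendFrom-[] zero    f j       = refl
  extendFrom-[] (suc i) f zero    = refl
  extendFrom-[] (suc i) f (suc j) = extendFrom-[] i (f ∘ suc) j

  setO-extendFrom : ∀ {k} v i n (ns : Vec ℕ k) →
    setO (record v { obj = extendFrom (suc i) ns (obj v) }) i n ≈ record v { obj = extendFrom i (n ∷ ns) (obj v) }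
  setO-extendFrom v i n ns = pointwise i (obj v) , refl
    where
    pointwise : ∀ i f j → (if j ≡ᵇ i then n else extendFrom (suc i) ns f j) ≡ extendFrom i (n ∷ ns) f j
    pointwise zero    f zero    = refl
    pointwise zero    f (suc j) = refl
    pointwise (suc i) f zero    = refl
    pointwise (suc i) f (suc j) = pointwise i (f ∘ suc) j

  Do-groundFrom⁻ : ∀ {k M v} i (ns : Vec ℕ k) {δ s s′} → Do M v (groundFrom i ns δ) s s′ →
                   Do M (record v { obj = extendFrom i ns (obj v) }) δ s s′
  Do-groundFrom⁻ {v = v} i []       D = Do-cong (extendFrom-[] i (obj v) , refl) D
  Do-groundFrom⁻ {v = v} i (n ∷ ns) D =
    Do-cong (setO-extendFrom v i n ns) (Do-substP⁻ i n (Do-groundFrom⁻ (suc i) ns D))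

  Do-⨾⁻ : ∀ {M v δ γ s s′} → Do M v (δ ⨾ γ) s s′ → Σ Sit λ s₁ → Do M v δ s s₁ × Do M v γ s₁ s′
  Do-⨾⁻ (_ , ts , f) = split ts f
    where
    split : ∀ {M v δ γ s δf sf} → Trans* M v (δ ⨾ γ) s δf sf → Final M v δf sf →
            Σ Sit λ s₁ → Do M v δ s s₁ × Do M v γ s₁ sf
    split {δ = δ} {γ} {s} ε (fSeq f g) = s , (δ , ε , f) , (γ , ε , g)
    split (tSeq₁ t ◅ ts) f with split ts f
    ... | s₁ , (δf , ts′ , f′) , D = s₁ , (δf , t ◅ ts′ , f′) , D
    split {δ = δ} {s = s} (tSeq₂ f t ◅ ts) g = s , (δ , ε , f) , (_ , t ◅ ts , g)

  Do-nil⁻ : ∀ {M v s s′} → Do M v nil s s′ → s ≡ s′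
  Do-nil⁻ (_ , ε , _)        = refl
  Do-nil⁻ (_ , (() ◅ _) , _)

  tabulate-extend : ∀ {k} (ns : Vec ℕ k) f → tabulate (λ i → extend ns f (toℕ i)) ≡ ns
  tabulate-extend []       f = refl
  tabulate-extend (n ∷ ns) f = cong (n ∷_) (tabulate-extend ns (f ∘ suc))

module RefinedFormulas {Sh Sl : Sig} (m : Refinement {Sh} {Sl}) (Ml : Syntax.Structure Sl) where
  module H = Syntax Sh
  open Syntax Sl

  m⟦⟧-cong : ∀ {s s′} → (∀ F v → ⟦ mF m F ⟧ Ml v s ⇔ ⟦ mF m F ⟧ Ml v s′) →
             ∀ φ v → m⟦ φ ⟧ m Ml v s ⇔ m⟦ φ ⟧ m Ml v s′
  m⟦⟧-cong mF⇔ H.⊤ᶠ v = ⇔-id _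
  m⟦⟧-cong mF⇔ H.⊥ᶠ v = ⇔-id _
  m⟦⟧-cong mF⇔ (t H.=ₒ u) v = ⇔-id _
  m⟦⟧-cong mF⇔ (H.fl F ts) v = mF⇔ F (record v { obj = extend (map (evalO v) ts) (obj v) })
  m⟦⟧-cong mF⇔ (H.¬ᶠ φ) v = ¬-cong-⇔ (m⟦⟧-cong mF⇔ φ v)
  m⟦⟧-cong mF⇔ (φ H.∧ᶠ ψ) v = m⟦⟧-cong mF⇔ φ v ×-⇔ m⟦⟧-cong mF⇔ ψ v
  m⟦⟧-cong mF⇔ (φ H.∨ᶠ ψ) v = m⟦⟧-cong mF⇔ φ v ⊎-⇔ m⟦⟧-cong mF⇔ ψ v
  m⟦⟧-cong mF⇔ (φ H.⇒ᶠ ψ) v = →-cong-⇔ (m⟦⟧-cong mF⇔ φ v) (m⟦⟧-cong mF⇔ ψ v)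
  m⟦⟧-cong mF⇔ (H.∀ₒ x φ) v = Π-cong-⇔ λ n → m⟦⟧-cong mF⇔ φ (setO v x n)
  m⟦⟧-cong mF⇔ (H.∃ₒ x φ) v = Σ-cong-⇔ λ n → m⟦⟧-cong mF⇔ φ (setO v x n)

module Bisimulation {Sh Sl : Sig} (m : Refinement {Sh} {Sl})
                    (Mh : Syntax.Structure Sh) (Ml : Syntax.Structure Sl)
                    (B : Syntax.Sit Sh → Syntax.Sit Sl → Set) (B-bisim : IsBisim m Mh Ml B) where
  module H = Syntax Sh
  open Syntax Sl
  open Execution Sl
  open RefinedFormulas m Ml using (m⟦⟧-cong)

  doₛ⋆ : List H.Act → H.Sit → H.Sit
  doₛ⋆ []       sh = sh
  doₛ⋆ (α ∷ αs) sh = doₛ⋆ αs (H.doₛ α sh)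

  B-mGround : ∀ v α {sh sl s} → B sh sl → Do Ml v (mGround m α) sl s → B (H.doₛ α sh) s
  B-mGround v (A , ns) {sh} {sl} {s} b D
    with proj₂ (proj₂ (B-bisim sh sl b)) A (record v { obj = extend ns (obj v) }) s (Do-groundFrom⁻ 0 ns D)
  ... | _ , _ , refl , b′ = subst (λ ns′ → B (H.doₛ (A , ns′) sh) s) (tabulate-extend ns (obj v)) b′

  B-mSeq : ∀ v αs {sh sl s} → B sh sl → Do Ml v (mSeq m αs) sl s → B (doₛ⋆ αs sh) s
  B-mSeq v []           b D = subst (B _) (Do-nil⁻ D) b
  B-mSeq v (α ∷ [])     b D = B-mGround v α b D
  B-mSeq v (α ∷ β ∷ αs) b D =
    let _ , Dα , Dαs = Do-⨾⁻ D in B-mSeq v (β ∷ αs) (B-mGround v α b Dα) Dαs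

  m⟦⟧-B-invariant : ∀ {sh s s′} → B sh s → B sh s′ → ∀ φ v → m⟦ φ ⟧ m Ml v s ⇔ m⟦ φ ⟧ m Ml v s′
  m⟦⟧-B-invariant {sh} {s} {s′} b b′ = m⟦⟧-cong λ F v →
    proj₁ (B-bisim sh s′ b′) F v ⇔-∘ ⇔-sym (proj₁ (B-bisim sh s b) F v)

open Defs using (BAT; Model; str; Act; Fm; Env; Sit; S₀; Do)

corollary2 : {Sh Sl : Sig} (Dh : BAT Sh) (Dl : BAT Sl) (m : Refinement {Sh} {Sl}) →
    IsRefinement Dl m → SoundAbstraction Dh Dl m →
    (αs : List (Act Sh)) (φ : Fm Sh false) →
    (Ml : Model Sl Dl) (v : Env Sl) (s s′ : Sit Sl) →
    Do Sl (str Ml) v (mSeq m αs) (S₀ {Sl}) s →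
    Do Sl (str Ml) v (mSeq m αs) (S₀ {Sl}) s′ →
    (m⟦ φ ⟧ m (str Ml) v s ⇔ m⟦ φ ⟧ m (str Ml) v s′)
corollary2 Dh Dl m _ sound αs φ Ml v s s′ D D′ with sound Ml
... | Mh , B , B-bisim , B₀ =
  m⟦⟧-B-invariant (B-mSeq v αs B₀ D) (B-mSeq v αs B₀ D′) φ v
  where open Bisimulation m (str Mh) (str Ml) B B-bisim
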